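{- Let $X=(X,\langle o,\partial\rangle)$ be a prechart and let $s\colon X\to \mathrm{SExp}$ be a map. Then $s$ is a solution to $X$ if and only if $[-]_{\equiv}\circ s\colon X\to \mathrm{SExp}/{\equiv}$ is a coalgebra homomorphism of precharts.
   Context: Fix a finite set $A$ of actions. A prechart is a pair $(X,\langle o,\partial\rangle)$ where $X$ is a set, $o\colon X\to 2^A$ and $\partial\colon X\to \mathcal P_\omega(X)^A$, with $\mathcal P_\omega(X)$ the set of finite subsets of $X$. Write $x\Rightarrow a$ if $o(x)(a)=1$ and $x\xrightarrow{a}y$ if $y\in\partial(x)(a)$. Precharts are coalgebras for the functor $P(X)=2^A\times\mathcal P_\omega(X)^A$, $P(f)(o,h)(a)=(o(a),f[h(a)])$; a homomorphism $h\colon X\to Y$ of precharts is a map with $\langle o_Y,\partial_Y\rangle\circ h=P(h)\circ\langle o_X,\partial_X\rangle$. The set $\mathrm{SExp}$ of ($1$-free) star expressions is generated by $e,f::=a\in A\mid 0\mid e+f\mid ef\mid e*f$. It is a prechart whose outputs and transitions are exactly those derivable by: $a\Rightarrow a$ for $a\in A$; if $e_i\Rightarrow a$ ($i\in\{1,2\}$) then $e_1+e_2\Rightarrow a$; if $e_i\xrightarrow{a}f$ then $e_1+e_2\xrightarrow{a}f$; if $e_1\Rightarrow a$ then $e_1e_2\xrightarrow{a}e_2$; if $e_1\xrightarrow{a}f$ then $e_1e_2\xrightarrow{a}fe_2$; if $e_2\Rightarrow a$ then $e_1*e_2\Rightarrow a$; if $e_2\xrightarrow{a}f$ then $e_1*e_2\xrightarrow{a}f$;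 if $e_1\xrightarrow{a}f$ then $e_1*e_2\xrightarrow{a}f(e_1*e_2)$; if $e_1\Rightarrow a$ then $e_1*e_2\xrightarrow{a}e_1*e_2$. $\equiv$ is the smallest congruence on $\mathrm{SExp}$ containing all instances of: $e_1+e_2\equiv e_2+e_1$; $e_1+(e_2+e_3)\equiv(e_1+e_2)+e_3$; $e_1+e_1\equiv e_1$; $(e_1+e_2)e_3\equiv e_1e_3+e_2e_3$; $e_1(e_2e_3)\equiv(e_1e_2)e_3$; $e_1+0\equiv e_1$; $0e_1\equiv 0$; $e_1*e_2\equiv e_1(e_1*e_2)+e_2$; $(e_1*e_2)e_3\equiv e_1*(e_2e_3)$; and closed under the rule: if $e_3\equiv e_1e_3+e_2$ then $e_3\equiv e_1*e_2$. The relation $\equiv$ is a bisimulation equivalence on $\mathrm{SExp}$, so $\mathrm{SExp}/{\equiv}$ carries a unique prechart structure making the quotient map $[-]_\equiv$ a homomorphism. A solution to a prechart $X$ is a map $s\colon X\to\mathrm{SExp}$ such that for all $x\in X$, $s(x)\equiv\sum_{x\Rightarrow a}a+\sum_{x\xrightarrow{a}x'}a\,s(x')$, where the (finite) sums are taken up to associativity and commutativity of $+$ and the empty sum is $0$. -}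

module Defs where

open import Data.Nat using (ℕ)
open import Data.Fin using (Fin; _≟_)
open import Data.Bool using (Bool; true; false; _∨_; if_then_else_)
open import Data.List using (List; []; _∷_; _++_; map; concatMap)
open import Data.List.Membership.Propositional using (_∈_)
open import Data.List.Relation.Binary.Subset.Propositional using ()
open import Data.Product using (Σ; _×_; ∃; ∃-syntax)
open import Data.Vec.Functional using ()
open import Relation.Nullary using (does)
open import Relation.Binary.PropositionalEquality using (_≡_)
open import Function.Bundles using (_⇔_)
open import Data.List using (allFin) public

-- A prechart: o : X → 2^A, ∂ : X → P_ω(X)^A.
-- Finite subsets are represented by lists; only membership matters.
record Prechart (n : ℕ) : Set₁ where
  field
    Carrier : Set
    o       : Carrier → Fin n → Bool
    ∂       : Carrier → Fin n → List Carrier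
open Prechart public

infixl 6 _⊕_
infixl 7 _⊙_
infixl 8 _⊛_
data SExp (n : ℕ) : Set where
  act  : Fin n → SExp n
  𝟘    : SExp n
  _⊕_  : SExp n → SExp n → SExp n
  _⊙_  : SExp n → SExp n → SExp n
  _⊛_  : SExp n → SExp n → SExp n

outS : ∀ {n} → SExp n → Fin n → Bool
outS (act b)  a = does (b ≟ a)
outS 𝟘        a = false
outS (e ⊕ f)  a = outS e a ∨ outS f a
outS (e ⊙ f)  a = false
outS (e ⊛ f)  a = outS f a

derS : ∀ {n} → SExp n → Fin n → List (SExp n)
derS (act b)  a = []
derS 𝟘        a = []
derS (e ⊕ f)  a = derS e a ++ derS f a
derS (e ⊙ f)  a = (if outS e a then f ∷ [] else [])
                  ++ map (λ g → g ⊙ f) (derS e a)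
derS (e ⊛ f)  a = derS f a
                  ++ map (λ g → g ⊙ (e ⊛ f)) (derS e a)
                  ++ (if outS e a then (e ⊛ f) ∷ [] else [])

SExpPrechart : (n : ℕ) → Prechart n
SExpPrechart n = record { Carrier = SExp n ; o = outS ; ∂ = derS }

-- The provable equivalence ≡ of the paper (written _≈_): the smallest
-- congruence containing the axioms and closed under the fixpoint rule.
infix 4 _≈_
data _≈_ {n : ℕ} : SExp n → SExp n → Set where
  ≈-refl  : ∀ {e} → e ≈ e
  ≈-sym   : ∀ {e f} → e ≈ f → f ≈ e
  ≈-trans : ∀ {e f g} → e ≈ f → f ≈ g → e ≈ g
  ⊕-cong  : ∀ {e e' f f'} → e ≈ e' → f ≈ f' → e ⊕ f ≈ e' ⊕ f'
  ⊙-cong  : ∀ {e e' f f'} → e ≈ e' → f ≈ f' → e ⊙ f ≈ e' ⊙ f'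
  ⊛-cong  : ∀ {e e' f f'} → e ≈ e' → f ≈ f' → e ⊛ f ≈ e' ⊛ f'
  ⊕-comm   : ∀ e₁ e₂ → e₁ ⊕ e₂ ≈ e₂ ⊕ e₁
  ⊕-assoc  : ∀ e₁ e₂ e₃ → e₁ ⊕ (e₂ ⊕ e₃) ≈ (e₁ ⊕ e₂) ⊕ e₃
  ⊕-idem   : ∀ e₁ → e₁ ⊕ e₁ ≈ e₁
  distr    : ∀ e₁ e₂ e₃ → (e₁ ⊕ e₂) ⊙ e₃ ≈ e₁ ⊙ e₃ ⊕ e₂ ⊙ e₃
  ⊙-assoc  : ∀ e₁ e₂ e₃ → e₁ ⊙ (e₂ ⊙ e₃) ≈ (e₁ ⊙ e₂) ⊙ e₃
  ⊕-𝟘      : ∀ e₁ → e₁ ⊕ 𝟘 ≈ e₁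
  𝟘-⊙      : ∀ e₁ → 𝟘 ⊙ e₁ ≈ 𝟘
  unroll   : ∀ e₁ e₂ → e₁ ⊛ e₂ ≈ e₁ ⊙ (e₁ ⊛ e₂) ⊕ e₂
  ⊛-⊙      : ∀ e₁ e₂ e₃ → (e₁ ⊛ e₂) ⊙ e₃ ≈ e₁ ⊛ (e₂ ⊙ e₃)
  rsp      : ∀ {e₁ e₂ e₃} → e₃ ≈ e₁ ⊙ e₃ ⊕ e₂ → e₃ ≈ e₁ ⊛ e₂

Σ⊕ : ∀ {n} → List (SExp n) → SExp n
Σ⊕ []       = 𝟘
Σ⊕ (e ∷ es) = e ⊕ Σ⊕ es

outSum : ∀ {n} (X : Prechart n) → Carrier X → SExp n
outSum {n} X x =
  Σ⊕ (concatMap (λ a → if o X x a then act a ∷ [] else []) (allFin n))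

stepSum : ∀ {n} (X : Prechart n) → (Carrier X → SExp n) → Carrier X → SExp n
stepSum {n} X s x =
  Σ⊕ (concatMap (λ a → map (λ x' → act a ⊙ s x') (∂ X x a)) (allFin n))

IsSolution : ∀ {n} (X : Prechart n) → (Carrier X → SExp n) → Set
IsSolution X s = ∀ x → s x ≈ outSum X x ⊕ stepSum X s x

-- The prechart SExp/≡ is represented by the setoid (SExp n, _≈_), with
-- o([e]) = outS e and ∂([e])(a) = {[f] | f ∈ derS e a}.
-- Equality of finite subsets of SExp/≡ is extensional equality of the
-- sets of equivalence classes.
SameClasses : ∀ {n} → List (SExp n) → List (SExp n) → Set
SameClasses us vs =
  (∀ u → u ∈ us → ∃[ v ] (v ∈ vs × u ≈ v)) ×
  (∀ v → v ∈ vs → ∃[ u ] (u ∈ us × u ≈ v))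

IsHomToQuotient : ∀ {n} (X : Prechart n) → (Carrier X → SExp n) → Set
IsHomToQuotient X h =
  ∀ x a → (outS (h x) a ≡ o X x a)
        × SameClasses (derS (h x) a) (map h (∂ X x a))

-- If s x ≈ Σ a + Σ a·s(x′) then, since ≈ is a bisimulation up to ≈ (each axiom and rule
-- relates expressions with the same outputs and ≈-equal derivatives), s x has the outputs
-- and derivatives of that sum, which are exactly those of x pushed along s.  Conversely,
-- every expression is ≈ to the sum of its own outputs and of a·e′ over its derivatives
-- (by induction on the expression, unrolling stars once); for a homomorphism, this
-- expansion of s x is the right-hand side of the solution equation at x.
module Submission where

open import Defs
open import Algebra.Bundles using (CommutativeMonoid)
import Algebra.Properties.CommutativeSemigroup as CommutativeSemigroupProperties
open import Data.Bool using (Bool; true; false; _∨_; if_then_else_; T)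
open import Data.Bool.ListAction using (any)
open import Data.Bool.Properties using (∨-comm; ∨-assoc; ∨-idem; ∨-identityʳ)
open import Data.Empty using (⊥-elim)
open import Data.Fin using (Fin; _≟_)
open import Data.List using (List; []; _∷_; _++_; map; concatMap)
open import Data.List.Membership.Propositional using (_∈_; find; lose)
open import Data.List.Membership.Propositional.Properties using (∈-allFin)
open import Data.List.Membership.Setoid.Properties using (∈-map⁻; ∈-++⁻)
open import Data.List.Properties
  using (map-++; map-∘; map-concatMap; concatMap-cong; ++-assoc; ++-identityʳ)
open import Data.List.Relation.Binary.Permutation.Propositional
  using (_↭_; ↭-refl; ↭-reflexive; ↭-sym; ↭-trans)
open import Data.List.Relation.Binary.Permutation.Propositional.Properties
  using (Any-resp-↭; ++-commutativeMonoid; ++-comm; ++⁺ˡ)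
open import Data.List.Relation.Binary.Subset.Setoid using (_⊆_)
open import Data.List.Relation.Binary.Subset.Setoid.Properties using (⊆-refl; ⊆-trans; xs⊆xs++ys; ++⁺)
open import Data.List.Relation.Unary.Any using (Any; here; there)
import Data.List.Relation.Unary.Any as Any
import Data.List.Relation.Unary.Any.Properties as Anyₚ
open import Data.Nat using (ℕ)
open import Data.Product using (_×_; _,_; ∃-syntax; proj₁; proj₂)
open import Data.Sum using ([_,_]′; inj₁; inj₂)
open import Function using (id; _∘_; _⇔_; mk⇔; Equivalence)
open import Level using (0ℓ)
open import Relation.Binary.Bundles using (Setoid)
open import Relation.Binary.Structures using (IsEquivalence)
open import Relation.Binary.PropositionalEquality
  using (_≡_; refl; sym; trans; cong; cong₂; subst; module ≡-Reasoning)
import Relation.Binary.Reasoning.Setoid as SetoidReasoning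
open import Relation.Nullary using (Dec; does; yes; no)

T-does⇒ : {A : Set} (a? : Dec A) → T (does a?) → A
T-does⇒ (yes a) _ = a

T-does⇐ : {A : Set} (a? : Dec A) → A → T (does a?)
T-does⇐ (yes _) _ = _
T-does⇐ (no ¬a) a = ¬a a

T-injective : ∀ {x y} → T x ⇔ T y → x ≡ y
T-injective {false} {false} _   = refl
T-injective {false} {true}  x⇔y = ⊥-elim (Equivalence.from x⇔y _)
T-injective {true}  {false} x⇔y = ⊥-elim (Equivalence.to x⇔y _)
T-injective {true}  {true}  _   = refl

opt : {A : Set} → Bool → A → List A
opt b x = if b then x ∷ [] else []

Any-opt⁻ : {A : Set} {P : A → Set} {b : Bool} {x : A} → Any P (opt b x) → T b × P x
Any-opt⁻ {b = true} (here px) = _ , px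

Any-opt⁺ : {A : Set} {P : A → Set} {b : Bool} {x : A} → T b → P x → Any P (opt b x)
Any-opt⁺ {b = true} _ px = here px

map-opt : {A B : Set} (f : A → B) (b : Bool) (x : A) → map f (opt b x) ≡ opt b (f x)
map-opt f true  x = refl
map-opt f false x = refl

map-opt++map : {A B : Set} (g : A → B) (b : Bool) (x : A) (f : A → A) (us : List A) →
  map g (opt b x ++ map f us) ≡ opt b (g x) ++ map (g ∘ f) us
map-opt++map g b x f us = begin
  map g (opt b x ++ map f us)          ≡⟨ map-++ g (opt b x) (map f us) ⟩
  map g (opt b x) ++ map g (map f us)  ≡⟨ cong₂ _++_ (map-opt g b x) (sym (map-∘ us)) ⟩
  opt b (g x) ++ map (g ∘ f) us        ∎
  where open ≡-Reasoning

++-interchange-↭ : {A : Set} (ws xs ys zs : List A) →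
                   (ws ++ xs) ++ (ys ++ zs) ↭ (ws ++ ys) ++ (xs ++ zs)
++-interchange-↭ {A} = interchange
  where open CommutativeSemigroupProperties
               (CommutativeMonoid.commutativeSemigroup (++-commutativeMonoid {A = A}))

concatMap-++-↭ : {A B : Set} (f g : A → List B) (xs : List A) →
                 concatMap (λ x → f x ++ g x) xs ↭ concatMap f xs ++ concatMap g xs
concatMap-++-↭ f g []       = ↭-refl
concatMap-++-↭ f g (x ∷ xs) =
  ↭-trans (++⁺ˡ (f x ++ g x) (concatMap-++-↭ f g xs)) (++-interchange-↭ (f x) (g x) _ _)

≈-setoid : ℕ → Setoid 0ℓ 0ℓ
≈-setoid n = record
  { Carrier       = SExp n
  ; _≈_           = _≈_
  ; isEquivalence = record { refl = ≈-refl ; sym = ≈-sym ; trans = ≈-trans }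
  }

module _ {n : ℕ} where

  private
    S = ≈-setoid n
    Terms = List (SExp n)

  infix 4 _≐_
  _≐_ : Terms → Terms → Set
  us ≐ vs = _⊆_ S us vs × _⊆_ S vs us

  ≐-isEquivalence : IsEquivalence _≐_
  ≐-isEquivalence = record
    { refl  = ⊆-refl S , ⊆-refl S
    ; sym   = λ (p , q) → q , p
    ; trans = λ (p , q) (p′ , q′) → ⊆-trans S p p′ , ⊆-trans S q′ q
    }

  open IsEquivalence ≐-isEquivalence public
    using () renaming (refl to ≐-refl; sym to ≐-sym; trans to ≐-trans)

  ↭⇒≐ : ∀ {us vs} → us ↭ vs → us ≐ vs
  ↭⇒≐ p = Any-resp-↭ p , Any-resp-↭ (↭-sym p)

  ≡⇒≐ : ∀ {us vs} → us ≡ vs → us ≐ vs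
  ≡⇒≐ refl = ≐-refl

  ++⁺-≐ : ∀ {us us′ vs vs′} → us ≐ us′ → vs ≐ vs′ → us ++ vs ≐ us′ ++ vs′
  ++⁺-≐ (p , q) (p′ , q′) = ++⁺ S p p′ , ++⁺ S q q′

  ++⁺ʳ-≐ : ∀ us {vs vs′} → vs ≐ vs′ → us ++ vs ≐ us ++ vs′
  ++⁺ʳ-≐ us = ++⁺-≐ (≐-refl {us})

  ++-idem-≐ : ∀ us → us ++ us ≐ us
  ++-idem-≐ us = (λ x∈ → [ id , id ]′ (∈-++⁻ S us x∈)) , xs⊆xs++ys S us us

  map⁺-≐ : ∀ {f g : SExp n → SExp n} {us vs} → (∀ {u v} → u ≈ v → f u ≈ g v) →
           us ≐ vs → map f us ≐ map g vs
  map⁺-≐ f≈g (p , q) = map⁺-⊆ f≈g p , map⁺-⊆ (λ u≈v → ≈-sym (f≈g (≈-sym u≈v))) q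
    where
    map⁺-⊆ : ∀ {f g : SExp n → SExp n} {us vs} → (∀ {u v} → u ≈ v → f u ≈ g v) →
             _⊆_ S us vs → _⊆_ S (map f us) (map g vs)
    map⁺-⊆ f≈g us⊆vs x∈ =
      let (u , u∈us , x≈fu) = ∈-map⁻ S S x∈
      in Anyₚ.map⁺ (Any.map (λ u≈v → ≈-trans x≈fu (f≈g u≈v)) (us⊆vs u∈us))

  map-cong-≐ : ∀ {f g : SExp n → SExp n} → (∀ u → f u ≈ g u) → ∀ us → map f us ≐ map g us
  map-cong-≐ f≈g us = pointwise f≈g , pointwise (λ u → ≈-sym (f≈g u))
    where
    pointwise : ∀ {f g : SExp n → SExp n} → (∀ u → f u ≈ g u) → _⊆_ S (map f us) (map g us)
    pointwise f≈g x∈ = Anyₚ.map⁺ (Any.map (λ {u} x≈fu → ≈-trans x≈fu (f≈g u)) (Anyₚ.map⁻ x∈))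

  opt⁺-≐ : ∀ {b c} {x y : SExp n} → b ≡ c → x ≈ y → opt b x ≐ opt c y
  opt⁺-≐ {true}  refl x≈y =
    (λ { (here p) → here (≈-trans p x≈y) }) , (λ { (here p) → here (≈-trans p (≈-sym x≈y)) })
  opt⁺-≐ {false} refl _   = ≐-refl

  opt-∨-≐ : ∀ b c (x : SExp n) → opt (b ∨ c) x ≐ opt b x ++ opt c x
  opt-∨-≐ true  true  x = ≐-sym (++-idem-≐ (x ∷ []))
  opt-∨-≐ true  false x = ≐-refl
  opt-∨-≐ false c     x = ≐-refl

  opt-∨-map-++-≐ : ∀ b c x (f : SExp n → SExp n) us vs →
    opt (b ∨ c) x ++ map f (us ++ vs) ≐ (opt b x ++ map f us) ++ (opt c x ++ map f vs)
  opt-∨-map-++-≐ b c x f us vs = ≐-trans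
    (++⁺-≐ (opt-∨-≐ b c x) (≡⇒≐ (map-++ f us vs)))
    (↭⇒≐ (++-interchange-↭ (opt b x) (opt c x) (map f us) (map f vs)))

  concatMap⁺-≐ : {A : Set} {f g : A → Terms} → (∀ x → f x ≐ g x) → ∀ xs →
                 concatMap f xs ≐ concatMap g xs
  concatMap⁺-≐ f≐g []       = ≐-refl
  concatMap⁺-≐ f≐g (x ∷ xs) = ++⁺-≐ (f≐g x) (concatMap⁺-≐ f≐g xs)

  concatMap-⊆ : {A : Set} (f : A → Terms) (xs : List A) {vs : Terms} →
                (∀ x → _⊆_ S (f x) vs) → _⊆_ S (concatMap f xs) vs
  concatMap-⊆ f xs f⊆vs u∈ =
    let (x , u∈fx) = Any.satisfied (Anyₚ.concatMap⁻ f {xs = xs} u∈) in f⊆vs x u∈fx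

  ≐⇒SameClasses : ∀ {us vs : Terms} → us ≐ vs → SameClasses us vs
  ≐⇒SameClasses (p , q) = ⊆⇒covered p , λ v v∈vs →
    let (u , u∈us , v≈u) = ⊆⇒covered q v v∈vs in u , u∈us , ≈-sym v≈u
    where
    ⊆⇒covered : ∀ {us vs : Terms} → _⊆_ S us vs → ∀ u → u ∈ us → ∃[ v ] (v ∈ vs × u ≈ v)
    ⊆⇒covered us⊆vs u u∈us = find (us⊆vs (Any.map (λ { refl → ≈-refl }) u∈us))

  SameClasses⇒≐ : ∀ {us vs : Terms} → SameClasses us vs → us ≐ vs
  SameClasses⇒≐ (p , q) = covered⇒⊆ p , covered⇒⊆ λ v v∈vs →
    let (u , u∈us , u≈v) = q v v∈vs in u , u∈us , ≈-sym u≈v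
    where
    covered⇒⊆ : ∀ {us vs : Terms} → (∀ u → u ∈ us → ∃[ v ] (v ∈ vs × u ≈ v)) → _⊆_ S us vs
    covered⇒⊆ covered x∈us =
      let (u , u∈us , x≈u) = find x∈us ; (v , v∈vs , u≈v) = covered u u∈us
      in lose v∈vs (≈-trans x≈u u≈v)

  𝟘-⊕ : ∀ (e : SExp n) → 𝟘 ⊕ e ≈ e
  𝟘-⊕ e = ≈-trans (⊕-comm 𝟘 e) (⊕-𝟘 e)

  ⊕-left-comm : ∀ (e f g : SExp n) → e ⊕ (f ⊕ g) ≈ f ⊕ (e ⊕ g)
  ⊕-left-comm e f g = begin
    e ⊕ (f ⊕ g)  ≈⟨ ⊕-assoc e f g ⟩
    (e ⊕ f) ⊕ g  ≈⟨ ⊕-cong (⊕-comm e f) ≈-refl ⟩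
    (f ⊕ e) ⊕ g  ≈⟨ ≈-sym (⊕-assoc f e g) ⟩
    f ⊕ (e ⊕ g)  ∎
    where open SetoidReasoning S

  Σ⊕-absorbs-∈ : ∀ {u us} → Any (u ≈_) us → Σ⊕ us ≈ u ⊕ Σ⊕ us
  Σ⊕-absorbs-∈ {u} {v ∷ us} (here u≈v) = begin
    v ⊕ Σ⊕ us        ≈⟨ ⊕-cong (≈-sym (⊕-idem v)) ≈-refl ⟩
    (v ⊕ v) ⊕ Σ⊕ us  ≈⟨ ≈-sym (⊕-assoc v v (Σ⊕ us)) ⟩
    v ⊕ (v ⊕ Σ⊕ us)  ≈⟨ ⊕-cong (≈-sym u≈v) ≈-refl ⟩
    u ⊕ (v ⊕ Σ⊕ us)  ∎
    where open SetoidReasoning S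
  Σ⊕-absorbs-∈ {u} {v ∷ us} (there u∈us) =
    ≈-trans (⊕-cong ≈-refl (Σ⊕-absorbs-∈ u∈us)) (⊕-left-comm v u (Σ⊕ us))

  Σ⊕-absorbs-⊆ : ∀ {us vs} → _⊆_ S us vs → Σ⊕ vs ≈ Σ⊕ us ⊕ Σ⊕ vs
  Σ⊕-absorbs-⊆ {[]}     {vs} _     = ≈-sym (𝟘-⊕ (Σ⊕ vs))
  Σ⊕-absorbs-⊆ {u ∷ us} {vs} us⊆vs = begin
    Σ⊕ vs                ≈⟨ Σ⊕-absorbs-⊆ (λ x∈ → us⊆vs (there x∈)) ⟩
    Σ⊕ us ⊕ Σ⊕ vs        ≈⟨ ⊕-cong ≈-refl (Σ⊕-absorbs-∈ (us⊆vs (here ≈-refl))) ⟩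
    Σ⊕ us ⊕ (u ⊕ Σ⊕ vs)  ≈⟨ ⊕-left-comm (Σ⊕ us) u (Σ⊕ vs) ⟩
    u ⊕ (Σ⊕ us ⊕ Σ⊕ vs)  ≈⟨ ⊕-assoc u (Σ⊕ us) (Σ⊕ vs) ⟩
    (u ⊕ Σ⊕ us) ⊕ Σ⊕ vs  ∎
    where open SetoidReasoning S

  Σ⊕-cong : ∀ {us vs} → us ≐ vs → Σ⊕ us ≈ Σ⊕ vs
  Σ⊕-cong {us} {vs} (us⊆vs , vs⊆us) = begin
    Σ⊕ us          ≈⟨ Σ⊕-absorbs-⊆ vs⊆us ⟩
    Σ⊕ vs ⊕ Σ⊕ us  ≈⟨ ⊕-comm (Σ⊕ vs) (Σ⊕ us) ⟩
    Σ⊕ us ⊕ Σ⊕ vs  ≈⟨ ≈-sym (Σ⊕-absorbs-⊆ us⊆vs) ⟩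
    Σ⊕ vs          ∎
    where open SetoidReasoning S

  Σ⊕-++ : ∀ (us vs : Terms) → Σ⊕ (us ++ vs) ≈ Σ⊕ us ⊕ Σ⊕ vs
  Σ⊕-++ []       vs = ≈-sym (𝟘-⊕ (Σ⊕ vs))
  Σ⊕-++ (u ∷ us) vs = ≈-trans (⊕-cong ≈-refl (Σ⊕-++ us vs)) (⊕-assoc u (Σ⊕ us) (Σ⊕ vs))

  Σ⊕-map-⊙ : ∀ (f : SExp n) us → Σ⊕ (map (_⊙ f) us) ≈ Σ⊕ us ⊙ f
  Σ⊕-map-⊙ f []       = ≈-sym (𝟘-⊙ f)
  Σ⊕-map-⊙ f (u ∷ us) = ≈-trans (⊕-cong ≈-refl (Σ⊕-map-⊙ f us)) (≈-sym (distr u (Σ⊕ us) f))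

  outS-Σ⊕ : ∀ (us : Terms) a → outS (Σ⊕ us) a ≡ any (λ u → outS u a) us
  outS-Σ⊕ []       a = refl
  outS-Σ⊕ (u ∷ us) a = cong (outS u a ∨_) (outS-Σ⊕ us a)

  derS-Σ⊕ : ∀ (us : Terms) a → derS (Σ⊕ us) a ≡ concatMap (λ u → derS u a) us
  derS-Σ⊕ []       a = refl
  derS-Σ⊕ (u ∷ us) a = cong (derS u a ++_) (derS-Σ⊕ us a)

  record StepEq (e f : SExp n) : Set where
    constructor stepEq
    field
      out-≡ : ∀ a → outS e a ≡ outS f a
      der-≐ : ∀ a → derS e a ≐ derS f a
  open StepEq public

  StepEq-refl : ∀ {e} → StepEq e e
  StepEq-refl = stepEq (λ _ → refl) (λ _ → ≐-refl)

  StepEq-sym : ∀ {e f} → StepEq e f → StepEq f e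
  StepEq-sym p = stepEq (sym ∘ out-≡ p) (≐-sym ∘ der-≐ p)

  StepEq-trans : ∀ {e f g} → StepEq e f → StepEq f g → StepEq e g
  StepEq-trans p q =
    stepEq (λ a → trans (out-≡ p a) (out-≡ q a)) (λ a → ≐-trans (der-≐ p a) (der-≐ q a))

  ⊕-step : ∀ {e e′ f f′} → StepEq e e′ → StepEq f f′ → StepEq (e ⊕ f) (e′ ⊕ f′)
  ⊕-step p q =
    stepEq (λ a → cong₂ _∨_ (out-≡ p a) (out-≡ q a)) (λ a → ++⁺-≐ (der-≐ p a) (der-≐ q a))

  ⊙-step : ∀ {e e′ f f′} → StepEq e e′ → f ≈ f′ → StepEq (e ⊙ f) (e′ ⊙ f′)
  ⊙-step p f≈f′ = stepEq (λ _ → refl)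
    (λ a → ++⁺-≐ (opt⁺-≐ (out-≡ p a) f≈f′) (map⁺-≐ (λ r → ⊙-cong r f≈f′) (der-≐ p a)))

  ⊛-step : ∀ {e e′ f f′} → StepEq e e′ → StepEq f f′ → e ⊛ f ≈ e′ ⊛ f′ →
           StepEq (e ⊛ f) (e′ ⊛ f′)
  ⊛-step p q star≈ = stepEq (out-≡ q) λ a →
    ++⁺-≐ (der-≐ q a)
          (++⁺-≐ (map⁺-≐ (λ r → ⊙-cong r star≈) (der-≐ p a)) (opt⁺-≐ (out-≡ p a) star≈))

  ⊕-comm-step : ∀ e f → StepEq (e ⊕ f) (f ⊕ e)
  ⊕-comm-step e f = stepEq
    (λ a → ∨-comm (outS e a) (outS f a))
    (λ a → ↭⇒≐ (++-comm (derS e a) (derS f a)))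

  ⊕-assoc-step : ∀ e f g → StepEq (e ⊕ (f ⊕ g)) ((e ⊕ f) ⊕ g)
  ⊕-assoc-step e f g = stepEq
    (λ a → sym (∨-assoc (outS e a) (outS f a) (outS g a)))
    (λ a → ≡⇒≐ (sym (++-assoc (derS e a) (derS f a) (derS g a))))

  ⊕-idem-step : ∀ e → StepEq (e ⊕ e) e
  ⊕-idem-step e = stepEq (λ a → ∨-idem (outS e a)) (λ a → ++-idem-≐ (derS e a))

  ⊕-𝟘-step : ∀ e → StepEq (e ⊕ 𝟘) e
  ⊕-𝟘-step e = stepEq (λ a → ∨-identityʳ (outS e a)) (λ a → ≡⇒≐ (++-identityʳ (derS e a)))

  distr-step : ∀ e f g → StepEq ((e ⊕ f) ⊙ g) (e ⊙ g ⊕ f ⊙ g)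
  distr-step e f g = stepEq (λ _ → refl)
    (λ a → opt-∨-map-++-≐ (outS e a) (outS f a) g (_⊙ g) (derS e a) (derS f a))

  ⊙-assoc-step : ∀ e f g → StepEq (e ⊙ (f ⊙ g)) ((e ⊙ f) ⊙ g)
  ⊙-assoc-step e f g = stepEq (λ _ → refl) λ a → ≐-trans
    (++⁺ʳ-≐ (opt (outS e a) (f ⊙ g)) (map-cong-≐ (λ h → ⊙-assoc h f g) (derS e a)))
    (≡⇒≐ (sym (map-opt++map (_⊙ g) (outS e a) f (_⊙ f) (derS e a))))

  unroll-step : ∀ e f → StepEq (e ⊙ (e ⊛ f) ⊕ f) (e ⊛ f)
  unroll-step e f = stepEq (λ _ → refl) λ a →
    let O = opt (outS e a) (e ⊛ f) ; M = map (_⊙ (e ⊛ f)) (derS e a) ; D = derS f a in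
    ↭⇒≐ (↭-trans (++-comm (O ++ M) D) (++⁺ˡ D (++-comm O M)))

  ⊛-⊙-step : ∀ e f g → StepEq ((e ⊛ f) ⊙ g) (e ⊛ (f ⊙ g))
  ⊛-⊙-step e f g = stepEq (λ _ → refl) λ a →
    ≐-trans (≡⇒≐ (regroup a))
            (++⁺ʳ-≐ (opt (outS f a) g ++ map (_⊙ g) (derS f a)) (++⁺-≐ (shift-map a) (shift-opt a)))
    where
    M : Fin n → Terms
    M a = map (_⊙ (e ⊛ f)) (derS e a)
    O : Fin n → Terms
    O a = opt (outS e a) (e ⊛ f)
    regroup : ∀ a → opt (outS f a) g ++ map (_⊙ g) (derS f a ++ (M a ++ O a))
              ≡ (opt (outS f a) g ++ map (_⊙ g) (derS f a)) ++ (map (_⊙ g) (M a) ++ map (_⊙ g) (O a))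
    regroup a = begin
      opt (outS f a) g ++ map (_⊙ g) (derS f a ++ (M a ++ O a))
        ≡⟨ cong (opt (outS f a) g ++_) (map-++ (_⊙ g) (derS f a) (M a ++ O a)) ⟩
      opt (outS f a) g ++ (map (_⊙ g) (derS f a) ++ map (_⊙ g) (M a ++ O a))
        ≡⟨ sym (++-assoc (opt (outS f a) g) (map (_⊙ g) (derS f a)) _) ⟩
      (opt (outS f a) g ++ map (_⊙ g) (derS f a)) ++ map (_⊙ g) (M a ++ O a)
        ≡⟨ cong ((opt (outS f a) g ++ map (_⊙ g) (derS f a)) ++_) (map-++ (_⊙ g) (M a) (O a)) ⟩
      (opt (outS f a) g ++ map (_⊙ g) (derS f a)) ++ (map (_⊙ g) (M a) ++ map (_⊙ g) (O a))
        ∎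
      where open ≡-Reasoning
    shift-map : ∀ a → map (_⊙ g) (M a) ≐ map (_⊙ (e ⊛ (f ⊙ g))) (derS e a)
    shift-map a = ≐-trans (≡⇒≐ (sym (map-∘ (derS e a))))
      (map-cong-≐ (λ h → ≈-trans (≈-sym (⊙-assoc h (e ⊛ f) g)) (⊙-cong ≈-refl (⊛-⊙ e f g)))
                  (derS e a))
    shift-opt : ∀ a → map (_⊙ g) (O a) ≐ opt (outS e a) (e ⊛ (f ⊙ g))
    shift-opt a = ≐-trans (≡⇒≐ (map-opt (_⊙ g) (outS e a) (e ⊛ f))) (opt⁺-≐ refl (⊛-⊙ e f g))

  ≈⇒StepEq : ∀ {e f} → e ≈ f → StepEq e f
  ≈⇒StepEq ≈-refl              = StepEq-refl
  ≈⇒StepEq (≈-sym p)           = StepEq-sym (≈⇒StepEq p)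
  ≈⇒StepEq (≈-trans p q)       = StepEq-trans (≈⇒StepEq p) (≈⇒StepEq q)
  ≈⇒StepEq (⊕-cong p q)        = ⊕-step (≈⇒StepEq p) (≈⇒StepEq q)
  ≈⇒StepEq (⊙-cong p q)        = ⊙-step (≈⇒StepEq p) q
  ≈⇒StepEq (⊛-cong p q)        = ⊛-step (≈⇒StepEq p) (≈⇒StepEq q) (⊛-cong p q)
  ≈⇒StepEq (⊕-comm e f)        = ⊕-comm-step e f
  ≈⇒StepEq (⊕-assoc e f g)     = ⊕-assoc-step e f g
  ≈⇒StepEq (⊕-idem e)          = ⊕-idem-step e
  ≈⇒StepEq (distr e f g)       = distr-step e f g
  ≈⇒StepEq (⊙-assoc e f g)     = ⊙-assoc-step e f g
  ≈⇒StepEq (⊕-𝟘 e)             = ⊕-𝟘-step e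
  ≈⇒StepEq (𝟘-⊙ e)             = stepEq (λ _ → refl) (λ _ → ≐-refl)
  ≈⇒StepEq (unroll e f)        = StepEq-sym (unroll-step e f)
  ≈⇒StepEq (⊛-⊙ e f g)         = ⊛-⊙-step e f g
  -- rsp p itself only enters as the ≈-proof replacing g by e ⊛ f, not as a recursive call.
  ≈⇒StepEq (rsp {e} {f} {g} p) = StepEq-trans (≈⇒StepEq p)
    (StepEq-trans (⊕-step (⊙-step StepEq-refl (rsp p)) StepEq-refl) (unroll-step e f))

  summandsAt : Fin n → Bool → Terms → Terms
  summandsAt a b us = opt b (act a) ++ map (act a ⊙_) us

  summands : (Fin n → Bool) → (Fin n → Terms) → Terms
  summands o d = concatMap (λ a → summandsAt a (o a) (d a)) (allFin n)

  summands-cong : ∀ {o o′ d d′} → (∀ a → o a ≡ o′ a) → (∀ a → d a ≐ d′ a) →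
                  summands o d ≐ summands o′ d′
  summands-cong o≡o′ d≐d′ = concatMap⁺-≐
    (λ a → ++⁺-≐ (opt⁺-≐ (o≡o′ a) ≈-refl) (map⁺-≐ (⊙-cong ≈-refl) (d≐d′ a))) (allFin n)

  summands-∨-++ : ∀ o o′ d d′ →
    summands (λ a → o a ∨ o′ a) (λ a → d a ++ d′ a) ≐ summands o d ++ summands o′ d′
  summands-∨-++ o o′ d d′ = ≐-trans
    (concatMap⁺-≐ (λ a → opt-∨-map-++-≐ (o a) (o′ a) (act a) (act a ⊙_) (d a) (d′ a)) (allFin n))
    (↭⇒≐ (concatMap-++-↭ (λ a → summandsAt a (o a) (d a)) (λ a → summandsAt a (o′ a) (d′ a))
                         (allFin n)))

  summands-⊙ : ∀ o d f →
    summands (λ _ → false) (λ a → opt (o a) f ++ map (_⊙ f) (d a)) ≐ map (_⊙ f) (summands o d)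
  summands-⊙ o d f = ≐-trans (concatMap⁺-≐ reassociate (allFin n))
    (≡⇒≐ (sym (map-concatMap (_⊙ f) (λ a → summandsAt a (o a) (d a)) (allFin n))))
    where
    reassociate : ∀ a → map (act a ⊙_) (opt (o a) f ++ map (_⊙ f) (d a))
                        ≐ map (_⊙ f) (summandsAt a (o a) (d a))
    reassociate a = ≐-trans (≡⇒≐ (map-opt++map (act a ⊙_) (o a) f (_⊙ f) (d a))) (≐-trans
      (++⁺ʳ-≐ (opt (o a) (act a ⊙ f)) (map-cong-≐ (λ u → ⊙-assoc (act a) u f) (d a)))
      (≡⇒≐ (sym (map-opt++map (_⊙ f) (o a) (act a) (act a ⊙_) (d a)))))

  summands-act : ∀ b → summands (outS (act b)) (derS (act b)) ≐ act b ∷ []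
  summands-act b = concatMap-⊆ _ (allFin n) only-b , λ u∈ →
    Anyₚ.concatMap⁺ _ (lose (∈-allFin b)
      (Anyₚ.++⁺ˡ (Any-opt⁺ (T-does⇐ (b ≟ b) refl) (Anyₚ.singleton⁻ u∈))))
    where
    only-b : ∀ a → _⊆_ S (summandsAt a (does (b ≟ a)) []) (act b ∷ [])
    only-b a with b ≟ a
    ... | yes refl = id
    ... | no _     = λ ()

  summands-𝟘 : summands (outS 𝟘) (derS 𝟘) ≐ []
  summands-𝟘 = concatMap-⊆ _ (allFin n) (λ _ ()) , λ ()

  Expands : SExp n → Set
  Expands e = e ≈ Σ⊕ (summands (outS e) (derS e))

  Expands-⊕ : ∀ {e f} → Expands e → Expands f → Expands (e ⊕ f)
  Expands-⊕ {e} {f} e≈ f≈ = ≈-trans (⊕-cong e≈ f≈) (≈-trans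
    (≈-sym (Σ⊕-++ (summands (outS e) (derS e)) (summands (outS f) (derS f))))
    (Σ⊕-cong (≐-sym (summands-∨-++ (outS e) (outS f) (derS e) (derS f)))))

  Expands-⊙ : ∀ {e} f → Expands e → Expands (e ⊙ f)
  Expands-⊙ {e} f e≈ = ≈-trans (⊙-cong e≈ ≈-refl) (≈-trans
    (≈-sym (Σ⊕-map-⊙ f (summands (outS e) (derS e))))
    (Σ⊕-cong (≐-sym (summands-⊙ (outS e) (derS e) f))))

  expands : ∀ e → Expands e
  expands (act b) = ≈-trans (≈-sym (⊕-𝟘 (act b))) (Σ⊕-cong (≐-sym (summands-act b)))
  expands 𝟘       = Σ⊕-cong (≐-sym summands-𝟘)
  expands (e ⊕ f) = Expands-⊕ (expands e) (expands f)
  expands (e ⊙ f) = Expands-⊙ f (expands e)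
  expands (e ⊛ f) = ≈-trans (unroll e f) (≈-trans
    (Expands-⊕ (Expands-⊙ (e ⊛ f) (expands e)) (expands f))
    (Σ⊕-cong (summands-cong (out-≡ (unroll-step e f)) (der-≐ (unroll-step e f)))))

  outS-Σ⊕-summands : ∀ o d a → outS (Σ⊕ (summands o d)) a ≡ o a
  outS-Σ⊕-summands o d a = trans (outS-Σ⊕ (summands o d) a) (T-injective (mk⇔ sound complete))
    where
    fires : SExp n → Bool
    fires u = outS u a
    fires-at : ∀ c → Any (T ∘ fires) (summandsAt c (o c) (d c)) → T (o a)
    fires-at c p with Anyₚ.++⁻ (opt (o c) (act c)) p
    ... | inj₁ p′ = let (oc , c=a) = Any-opt⁻ p′ in subst (T ∘ o) (T-does⇒ (c ≟ a) c=a) oc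
    ... | inj₂ p′ with () ← proj₂ (Any.satisfied (Anyₚ.map⁻ p′))
    sound : T (any fires (summands o d)) → T (o a)
    sound t =
      let (c , p) = Any.satisfied (Anyₚ.concatMap⁻ _ {xs = allFin n} (Anyₚ.any⁻ fires _ t))
      in fires-at c p
    complete : T (o a) → T (any fires (summands o d))
    complete t = Anyₚ.any⁺ fires (Anyₚ.concatMap⁺ _
      (lose (∈-allFin a) (Anyₚ.++⁺ˡ (Any-opt⁺ t (T-does⇐ (a ≟ a) refl)))))

  derS-Σ⊕-summands : ∀ o d a → derS (Σ⊕ (summands o d)) a ≐ d a
  derS-Σ⊕-summands o d a = ≐-trans (≡⇒≐ (derS-Σ⊕ (summands o d) a)) (sound , complete)
    where
    act⊙-der : ∀ {x} c {u} → Any (x ≈_) (derS (act c ⊙ u) a) → c ≡ a × x ≈ u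
    act⊙-der c {u} p with Anyₚ.++⁻ (opt (outS (act c) a) u) p
    ... | inj₁ q = let (c=a , x≈u) = Any-opt⁻ q in T-does⇒ (c ≟ a) c=a , x≈u
    sound-at : ∀ {x} c → Any (λ u → Any (x ≈_) (derS u a)) (summandsAt c (o c) (d c)) →
               Any (x ≈_) (d a)
    sound-at c p with Anyₚ.++⁻ (opt (o c) (act c)) p
    ... | inj₁ p′ with () ← proj₂ (Any-opt⁻ p′)
    ... | inj₂ p′ = let q = Anyₚ.map⁻ p′ in
      subst (λ c → Any _ (d c)) (proj₁ (act⊙-der c (proj₂ (Any.satisfied q))))
            (Any.map (proj₂ ∘ act⊙-der c) q)
    sound : _⊆_ S (concatMap (λ u → derS u a) (summands o d)) (d a)
    sound x∈ =
      let (c , p) = Any.satisfied (Anyₚ.concatMap⁻ _ {xs = allFin n} (Anyₚ.concatMap⁻ _ x∈))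
      in sound-at c p
    complete : _⊆_ S (d a) (concatMap (λ u → derS u a) (summands o d))
    complete x∈ = Anyₚ.concatMap⁺ _ (Anyₚ.concatMap⁺ _ (lose (∈-allFin a)
      (Anyₚ.++⁺ʳ (opt (o a) (act a))
        (Anyₚ.map⁺ (Any.map (λ x≈u → Anyₚ.++⁺ˡ (Any-opt⁺ (T-does⇐ (a ≟ a) refl) x≈u)) x∈)))))

  outSum⊕stepSum≈Σ⊕summands : ∀ (X : Prechart n) (s : Carrier X → SExp n) x →
    outSum X x ⊕ stepSum X s x ≈ Σ⊕ (summands (o X x) (λ a → map s (∂ X x a)))
  outSum⊕stepSum≈Σ⊕summands X s x = ≈-sym (≈-trans (Σ⊕-cong (↭⇒≐ split)) (Σ⊕-++ _ _))
    where
    split : summands (o X x) (λ a → map s (∂ X x a))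
            ↭ concatMap (λ a → opt (o X x a) (act a)) (allFin n)
              ++ concatMap (λ a → map (λ x′ → act a ⊙ s x′) (∂ X x a)) (allFin n)
    split = ↭-trans
      (↭-reflexive (concatMap-cong (λ a → cong (opt (o X x a) (act a) ++_) (sym (map-∘ (∂ X x a))))
                                   (allFin n)))
      (concatMap-++-↭ _ _ (allFin n))

lemma2p2 : (n : ℕ) (X : Prechart n) (s : Carrier X → SExp n) →
             IsSolution X s ⇔ IsHomToQuotient X s
lemma2p2 n X s = mk⇔ solution⇒hom hom⇒solution
  where
  expansion : Carrier X → SExp n
  expansion x = Σ⊕ (summands (o X x) (λ a → map s (∂ X x a)))

  solution⇒hom : IsSolution X s → IsHomToQuotient X s
  solution⇒hom sol x a =
    trans (out-≡ step a) (outS-Σ⊕-summands (o X x) _ a) ,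
    ≐⇒SameClasses (≐-trans (der-≐ step a) (derS-Σ⊕-summands (o X x) _ a))
    where
    step : StepEq (s x) (expansion x)
    step = ≈⇒StepEq (≈-trans (sol x) (outSum⊕stepSum≈Σ⊕summands X s x))

  hom⇒solution : IsHomToQuotient X s → IsSolution X s
  hom⇒solution hom x = begin
    s x
      ≈⟨ expands (s x) ⟩
    Σ⊕ (summands (outS (s x)) (derS (s x)))
      ≈⟨ Σ⊕-cong (summands-cong (proj₁ ∘ hom x) (SameClasses⇒≐ ∘ proj₂ ∘ hom x)) ⟩
    expansion x
      ≈⟨ ≈-sym (outSum⊕stepSum≈Σ⊕summands X s x) ⟩
    outSum X x ⊕ stepSum X s x
      ∎
    where open SetoidReasoning (≈-setoid n)
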